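{- For every positive integer $d$ there exists a binary matrix $M$ such that $R_{binary}(M)\ge 4d$ and $R_{\mathbb{R}}(M)=3d$.
   Context: A binary matrix has entries in $\{0,1\}$. $R_{\mathbb{R}}(M)$ is the usual rank over the reals. The binary rank $R_{binary}(M)$ of an $n\times m$ binary matrix $M$ is the minimal $k$ such that $M=U\cdot V$ with $U$ an $n\times k$ binary matrix and $V$ a $k\times m$ binary matrix, using ordinary integer arithmetic. -}

module Defs where

open import Data.Nat using (ℕ; zero; suc; _+_; _*_; _≤_; _<_)
open import Data.Bool using (Bool; true; false)
open import Data.Fin using (Fin; zero; suc)
open import Data.Product using (Σ; ∃; _×_; _,_)
open import Data.Rational using (ℚ; 0ℚ; 1ℚ) renaming (_+_ to _+ℚ_; _*_ to _*ℚ_)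
open import Relation.Binary.PropositionalEquality using (_≡_)
open import Relation.Nullary using (¬_)

BinMat : ℕ → ℕ → Set
BinMat n m = Fin n → Fin m → Bool

b2ℕ : Bool → ℕ
b2ℕ false = 0
b2ℕ true  = 1

b2ℚ : Bool → ℚ
b2ℚ false = 0ℚ
b2ℚ true  = 1ℚ

sumℕ : ∀ {k} → (Fin k → ℕ) → ℕ
sumℕ {zero}  f = 0
sumℕ {suc k} f = f zero + sumℕ (λ i → f (suc i))

sumℚ : ∀ {k} → (Fin k → ℚ) → ℚ
sumℚ {zero}  f = 0ℚ
sumℚ {suc k} f = f zero +ℚ sumℚ (λ i → f (suc i))

-- M = U · V with U : n × k binary, V : k × m binary, ordinary integer arithmetic
BinaryFactorization : ∀ {n m} → BinMat n m → ℕ → Set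
BinaryFactorization {n} {m} M k =
  Σ (BinMat n k) λ U → Σ (BinMat k m) λ V →
    ∀ i j → b2ℕ (M i j) ≡ sumℕ (λ l → b2ℕ (U i l) * b2ℕ (V l j))

BinaryRankAtLeast : ∀ {n m} → BinMat n m → ℕ → Set
BinaryRankAtLeast M r = ∀ k → BinaryFactorization M k → r ≤ k

LinIndep : ∀ {r n} → (Fin r → Fin n → ℚ) → Set
LinIndep {r} {n} v =
  ∀ (c : Fin r → ℚ) → (∀ i → sumℚ (λ t → c t *ℚ v t i) ≡ 0ℚ) → ∀ t → c t ≡ 0ℚ

columns : ∀ {n m r} → BinMat n m → (Fin r → Fin m) → Fin r → Fin n → ℚ
columns M f t i = b2ℚ (M i (f t))

-- rank of M (over ℚ, equal to the rank over ℝ for a rational matrix) is r :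
-- some r columns are linearly independent, and no r+1 columns are.
RankIs : ∀ {n m} → BinMat n m → ℕ → Set
RankIs {n} {m} M r =
  (Σ (Fin r → Fin m) λ f → LinIndep (columns M f)) ×
  (∀ (g : Fin (suc r) → Fin m) → ¬ LinIndep (columns M g))

{-# OPTIONS --safe #-}
module Submission where

-- M is block diagonal with d copies of C₄ = I + P, P the permutation matrix of the 4-cycle.
-- Its diagonal is a fooling set, as C₄ has no symmetric pair of off-diagonal ones, so a binary
-- factorization needs 4d rectangles. Over ℚ the first three columns of each block are
-- independent, while (1, −1, 1, −1) kills the four columns of a block; so any 3d + 1 columns
-- either contain a whole block or, by pigeonhole, repeat a column.

open import Defs
open import Data.Nat using (ℕ; zero; suc; _*_; _≤_; _<_; z≤n; s≤s)
open import Data.Product using (Σ; _×_; ∃; ∃₂; _,_; proj₁; proj₂; uncurry)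

open import Algebra.Bundles using (Ring)
open import Data.Bool using (true; false; T; _∧_; _∨_; if_then_else_)
open import Data.Empty using (⊥-elim)
open import Data.Fin using (Fin; zero; suc; combine; remQuot; punchOut; punchIn; inject₁)
open import Data.Fin.Patterns using (0F; 1F; 2F; 3F)
open import Data.Fin.Properties
  using (_≟_; *↔×; remQuot-combine; combine-remQuot; combine-surjective; combine-injective;
         combine-injectiveˡ; punchOut-injective; punchInᵢ≢i; pigeonhole; injective⇒≤; any?; all?;
         ¬∀⟶∃¬; <⇒≢)
open import Data.Nat.Properties using (n<1+n; m≤m+n; m≤n+m; ≤-trans; <-≤-trans)
open import Data.Rational using (ℚ; 0ℚ; 1ℚ; -_; _-_) renaming (_+_ to _+ℚ_; _*_ to _*ℚ_)
open import Data.Rational.Properties using (+-*-ring; +-identityʳ; *-zeroˡ; *-zeroʳ; 1≢0)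
open import Data.Rational.Solver using (module +-*-Solver)
open import Algebra.Properties.Semiring.Sum (Ring.semiring +-*-ring)
  using (sum; sum-cong-≗; sum-replicate-zero; sum-remove; ∑-comm)
open import Data.Sum using (_⊎_; inj₁; inj₂)
open import Data.Unit using (tt)
open import Data.Vec.Functional using (_∷_; [])
open import Function using (_∘_; id)
open import Function.Bundles using (Equivalence; _⇔_; mk⇔; Injection)
open import Function.Definitions using (Injective)
open import Function.Properties.Inverse using (↔⇒↣)
open import Relation.Binary.PropositionalEquality
open import Relation.Nullary using (¬_; yes; no; does; contradiction)
open import Relation.Nullary.Decidable using (dec-true; dec-false)

open Equivalence using (to; from)

sumℚ≡sum : ∀ {k} (f : Fin k → ℚ) → sumℚ f ≡ sum f
sumℚ≡sum {zero}  f = refl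
sumℚ≡sum {suc k} f = cong (f zero +ℚ_) (sumℚ≡sum (f ∘ suc))

sumℚ-cong : ∀ {k} {f g : Fin k → ℚ} → f ≗ g → sumℚ f ≡ sumℚ g
sumℚ-cong {f = f} {g} f≗g = trans (sumℚ≡sum f) (trans (sum-cong-≗ f≗g) (sym (sumℚ≡sum g)))

sumℚ-zero : ∀ {k} {f : Fin k → ℚ} → (∀ t → f t ≡ 0ℚ) → sumℚ f ≡ 0ℚ
sumℚ-zero {k} {f} f≗0 = trans (sumℚ≡sum f) (trans (sum-cong-≗ f≗0) (sum-replicate-zero k))

sumℚ-concentrated : ∀ {k} (p : Fin k) (f : Fin k → ℚ) →
                    (∀ t → t ≢ p → f t ≡ 0ℚ) → sumℚ f ≡ f p
sumℚ-concentrated {suc _} p f vanishes = begin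
  sumℚ f                                  ≡⟨ sumℚ≡sum f ⟩
  sum f                                   ≡⟨ sum-remove f ⟩
  f p +ℚ sum (f ∘ punchIn p)              ≡⟨ cong (f p +ℚ_) (sumℚ≡sum (f ∘ punchIn p)) ⟨
  f p +ℚ sumℚ (f ∘ punchIn p)             ≡⟨ cong (f p +ℚ_) (sumℚ-zero (vanishes _ ∘ punchInᵢ≢i p)) ⟩
  f p +ℚ 0ℚ                               ≡⟨ +-identityʳ (f p) ⟩
  f p                                     ∎
  where open ≡-Reasoning

sumℚ-swap : ∀ {k l} (f : Fin k → Fin l → ℚ) →
            sumℚ (λ s → sumℚ (f s)) ≡ sumℚ (λ t → sumℚ (λ s → f s t))
sumℚ-swap f = begin
  sumℚ (λ s → sumℚ (f s))              ≡⟨ sumℚ-cong (λ s → sumℚ≡sum (f s)) ⟩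
  sumℚ (λ s → sum (f s))               ≡⟨ sumℚ≡sum (λ s → sum (f s)) ⟩
  sum (λ s → sum (f s))                ≡⟨ ∑-comm f ⟩
  sum (λ t → sum (λ s → f s t))        ≡⟨ sumℚ≡sum (λ t → sum (λ s → f s t)) ⟨
  sumℚ (λ t → sum (λ s → f s t))       ≡⟨ sumℚ-cong (λ t → sumℚ≡sum (λ s → f s t)) ⟨
  sumℚ (λ t → sumℚ (λ s → f s t))      ∎
  where open ≡-Reasoning

pointMass : ∀ {n} → Fin n → ℚ → Fin n → ℚ
pointMass p a t = if does (t ≟ p) then a else 0ℚ

pointMass-self : ∀ {n} (p : Fin n) a → pointMass p a p ≡ a
pointMass-self p a rewrite dec-true (p ≟ p) refl = refl

pointMass-other : ∀ {n} {p t : Fin n} a → t ≢ p → pointMass p a t ≡ 0ℚ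
pointMass-other {p = p} {t} a t≢p rewrite dec-false (t ≟ p) t≢p = refl

sumℚ-pointMass-injective : ∀ {k n} {e : Fin k → Fin n} → Injective _≡_ _≡_ e →
                           (a : Fin k → ℚ) (p : Fin k) →
                           sumℚ (λ s → pointMass (e s) (a s) (e p)) ≡ a p
sumℚ-pointMass-injective {e = e} e-injective a p =
  trans (sumℚ-concentrated p _ (λ s s≢p → pointMass-other (a s) (s≢p ∘ sym ∘ e-injective)))
        (pointMass-self (e p) (a p))

-- F t = ∑ₛ [e s ≡ t] F (e s): on the image of e exactly one s contributes (injectivity), off
-- it F vanishes; swapping the two sums then leaves ∑ₛ F (e s).
sumℚ-reindex : ∀ {k n} {e : Fin k → Fin n} → Injective _≡_ _≡_ e → (F : Fin n → ℚ) →
               (∀ t → (∀ s → e s ≢ t) → F t ≡ 0ℚ) → sumℚ F ≡ sumℚ (F ∘ e)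
sumℚ-reindex {e = e} e-injective F outside = begin
  sumℚ F
    ≡⟨ sumℚ-cong fibre ⟩
  sumℚ (λ t → sumℚ (λ s → pointMass (e s) (F (e s)) t))
    ≡⟨ sumℚ-swap (λ s → pointMass (e s) (F (e s))) ⟨
  sumℚ (λ s → sumℚ (λ t → pointMass (e s) (F (e s)) t))
    ≡⟨ sumℚ-cong total ⟩
  sumℚ (F ∘ e) ∎
  where
  open ≡-Reasoning
  fibre : ∀ t → F t ≡ sumℚ (λ s → pointMass (e s) (F (e s)) t)
  fibre t with any? (λ s → e s ≟ t)
  ... | yes (p , refl) = sym (sumℚ-pointMass-injective e-injective (F ∘ e) p)
  ... | no unhit = trans (outside t (λ s es≡t → unhit (s , es≡t)))
                         (sym (sumℚ-zero (λ s → pointMass-other _ (λ t≡es → unhit (s , sym t≡es)))))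
  total : ∀ s → sumℚ (pointMass (e s) (F (e s))) ≡ F (e s)
  total s = trans (sumℚ-concentrated (e s) _ (λ t → pointMass-other _)) (pointMass-self (e s) _)

LinIndep-∘ : ∀ {k r n} {v : Fin r → Fin n → ℚ} {e : Fin k → Fin r} →
             Injective _≡_ _≡_ e → LinIndep v → LinIndep (v ∘ e)
LinIndep-∘ {r = r} {v = v} {e} e-injective independent c combination s = begin
  c s       ≡⟨ sumℚ-pointMass-injective e-injective c s ⟨
  c′ (e s)  ≡⟨ independent c′ c′-combination (e s) ⟩
  0ℚ        ∎
  where
  open ≡-Reasoning
  c′ : Fin r → ℚ
  c′ t = sumℚ (λ s → pointMass (e s) (c s) t)
  c′-combination : ∀ x → sumℚ (λ t → c′ t *ℚ v t x) ≡ 0ℚ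
  c′-combination x = begin
    sumℚ (λ t → c′ t *ℚ v t x)            ≡⟨ sumℚ-reindex e-injective _ outside ⟩
    sumℚ (λ s → c′ (e s) *ℚ v (e s) x)    ≡⟨ sumℚ-cong (λ s → cong (_*ℚ v (e s) x)
                                               (sumℚ-pointMass-injective e-injective c s)) ⟩
    sumℚ (λ s → c s *ℚ v (e s) x)         ≡⟨ combination x ⟩
    0ℚ                                    ∎
    where
    outside : ∀ t → (∀ s → e s ≢ t) → c′ t *ℚ v t x ≡ 0ℚ
    outside t unhit = trans (cong (_*ℚ v t x) (sumℚ-zero (λ s → pointMass-other (c s) (unhit s ∘ sym))))
                            (*-zeroˡ (v t x))

pair-injective : ∀ {n} {i j : Fin n} → i ≢ j → Injective _≡_ _≡_ (i ∷ j ∷ [])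
pair-injective i≢j {0F} {0F} _   = refl
pair-injective i≢j {0F} {1F} i≡j = contradiction i≡j i≢j
pair-injective i≢j {1F} {0F} j≡i = contradiction (sym j≡i) i≢j
pair-injective i≢j {1F} {1F} _   = refl

LinIndep-injective : ∀ {r n} {v : Fin r → Fin n → ℚ} → LinIndep v → ∀ {i j} → v i ≗ v j → i ≡ j
LinIndep-injective {v = v} independent {i} {j} vi≗vj with i ≟ j
... | yes i≡j = i≡j
... | no i≢j  =
  contradiction (LinIndep-∘ (pair-injective i≢j) independent (1ℚ ∷ - 1ℚ ∷ []) difference 0F) 1≢0
  where
  open +-*-Solver
  difference : ∀ x → 1ℚ *ℚ v i x +ℚ (- 1ℚ *ℚ v j x +ℚ 0ℚ) ≡ 0ℚ
  difference x rewrite vi≗vj x =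
    solve 1 (λ a → con 1ℚ :* a :+ (con (- 1ℚ) :* a :+ con 0ℚ) := con 0ℚ) refl (v j x)

sumℕ-positive : ∀ {k} (f : Fin k → ℕ) → 0 < sumℕ f → ∃ λ l → 0 < f l
sumℕ-positive {suc k} f 0<sum with f zero in f0≡
... | suc _ = zero , subst (0 <_) (sym f0≡) (s≤s z≤n)
... | zero  with sumℕ-positive (f ∘ suc) 0<sum
...   | l , 0<fl = suc l , 0<fl

term≤sumℕ : ∀ {k} (f : Fin k → ℕ) l → f l ≤ sumℕ f
term≤sumℕ f zero    = m≤m+n (f zero) _
term≤sumℕ f (suc l) = ≤-trans (term≤sumℕ (f ∘ suc) l) (m≤n+m _ (f zero))

T⇔b2ℕ-positive : ∀ {x} → T x ⇔ (0 < b2ℕ x)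
T⇔b2ℕ-positive {true}  = mk⇔ (λ _ → s≤s z≤n) (λ _ → tt)
T⇔b2ℕ-positive {false} = mk⇔ (λ ()) (λ ())

T×T⇔b2ℕ*-positive : ∀ {x y} → (T x × T y) ⇔ (0 < b2ℕ x * b2ℕ y)
T×T⇔b2ℕ*-positive {true}  {true}  = mk⇔ (λ _ → s≤s z≤n) (λ _ → tt , tt)
T×T⇔b2ℕ*-positive {true}  {false} = mk⇔ (λ ()) (λ ())
T×T⇔b2ℕ*-positive {false} {_}     = mk⇔ (λ ()) (λ ())

factorization-ones : ∀ {n m k} {M : BinMat n m} {U : BinMat n k} {V : BinMat k m} →
                     (∀ i j → b2ℕ (M i j) ≡ sumℕ (λ l → b2ℕ (U i l) * b2ℕ (V l j))) →
                     ∀ {i j} → T (M i j) ⇔ (∃ λ l → T (U i l) × T (V l j))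
factorization-ones {k = k} {M} {U} {V} M≡UV {i} {j} = mk⇔ rectangle-of entry-of
  where
  term : Fin k → ℕ
  term l = b2ℕ (U i l) * b2ℕ (V l j)
  rectangle-of : T (M i j) → ∃ λ l → T (U i l) × T (V l j)
  rectangle-of Mij with sumℕ-positive term (subst (0 <_) (M≡UV i j) (to T⇔b2ℕ-positive Mij))
  ... | l , 0<term = l , from T×T⇔b2ℕ*-positive 0<term
  entry-of : (∃ λ l → T (U i l) × T (V l j)) → T (M i j)
  entry-of (l , UV) = from T⇔b2ℕ-positive (subst (0 <_) (sym (M≡UV i j))
    (<-≤-trans (to T×T⇔b2ℕ*-positive UV) (term≤sumℕ term l)))

record FoolingSet {n m} (M : BinMat n m) (r : ℕ) : Set where
  field
    row   : Fin r → Fin n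
    col   : Fin r → Fin m
    hit   : ∀ s → T (M (row s) (col s))
    cross : ∀ s s′ → T (M (row s) (col s′)) → T (M (row s′) (col s)) → s ≡ s′

-- Each fooling cell lies in some rectangle of the factorization, and two fooling cells
-- never share one.
FoolingSet⇒BinaryRankAtLeast : ∀ {n m r} {M : BinMat n m} → FoolingSet M r → BinaryRankAtLeast M r
FoolingSet⇒BinaryRankAtLeast {M = M} fooling k (U , V , M≡UV) = injective⇒≤ rectangle-injective
  where
  open FoolingSet fooling
  ones : ∀ {i j} → T (M i j) ⇔ (∃ λ l → T (U i l) × T (V l j))
  ones = factorization-ones {U = U} {V} M≡UV
  rectangle : ∀ s → ∃ λ l → T (U (row s) l) × T (V l (col s))
  rectangle s = to ones (hit s)
  shared : ∀ s s′ → proj₁ (rectangle s) ≡ proj₁ (rectangle s′) → T (M (row s) (col s′))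
  shared s s′ same = from ones
    (proj₁ (rectangle s) , proj₁ (proj₂ (rectangle s)) ,
     subst (λ l → T (V l (col s′))) (sym same) (proj₂ (proj₂ (rectangle s′))))
  rectangle-injective : Injective _≡_ _≡_ (proj₁ ∘ rectangle)
  rectangle-injective {s} {s′} same = cross s s′ (shared s s′ same) (shared s′ s (sym same))

blockDiagonal : ∀ {n m} → BinMat n m → (d : ℕ) → BinMat (n * d) (m * d)
blockDiagonal {n} {m} A d i j =
  let (r , b) = remQuot {n} d i ; (r′ , b′) = remQuot {m} d j in does (b ≟ b′) ∧ A r r′

blockwise : ∀ {r n} (d : ℕ) → (Fin r → Fin n) → Fin (r * d) → Fin (n * d)
blockwise {r} d f t = let (s , b) = remQuot {r} d t in combine (f s) b

module _ {n m} (A : BinMat n m) (d : ℕ) where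

  blockDiagonal-combine : ∀ r b r′ b′ →
                          blockDiagonal A d (combine r b) (combine r′ b′) ≡ does (b ≟ b′) ∧ A r r′
  blockDiagonal-combine r b r′ b′ =
    cong₂ (λ (r , b) (r′ , b′) → does (b ≟ b′) ∧ A r r′) (remQuot-combine r b) (remQuot-combine r′ b′)

  blockDiagonal-diagonal : ∀ r r′ b → blockDiagonal A d (combine r b) (combine r′ b) ≡ A r r′
  blockDiagonal-diagonal r r′ b rewrite blockDiagonal-combine r b r′ b | dec-true (b ≟ b) refl = refl

  blockDiagonal-offDiagonal : ∀ r r′ {b b′} → b ≢ b′ →
                              blockDiagonal A d (combine r b) (combine r′ b′) ≡ false
  blockDiagonal-offDiagonal r r′ {b} {b′} b≢b′
    rewrite blockDiagonal-combine r b r′ b′ | dec-false (b ≟ b′) b≢b′ = refl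

  blockDiagonal-sameBlock : ∀ r r′ {b b′} → T (blockDiagonal A d (combine r b) (combine r′ b′)) → b ≡ b′
  blockDiagonal-sameBlock r r′ {b} {b′} entry with b ≟ b′
  ... | yes b≡b′ = b≡b′
  ... | no b≢b′  = ⊥-elim (subst T (blockDiagonal-offDiagonal r r′ b≢b′) entry)

blockwise-combine : ∀ {r n} d (f : Fin r → Fin n) s b → blockwise d f (combine s b) ≡ combine (f s) b
blockwise-combine d f s b = cong (λ (s , b) → combine (f s) b) (remQuot-combine s b)

combine-induction : ∀ {m} d {P : Fin (m * d) → Set} → (∀ s b → P (combine s b)) → ∀ t → P t
combine-induction {m} d h t with combine-surjective {m} {d} t
... | s , b , refl = h s b

blockDiagonal-foolingSet : ∀ {n m r d} {A : BinMat n m} → FoolingSet A r →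
                           FoolingSet (blockDiagonal A d) (r * d)
blockDiagonal-foolingSet {n} {m} {r} {d} {A} fooling = record
  { row   = blockwise d row
  ; col   = blockwise d col
  ; hit   = combine-induction d hit′
  ; cross = combine-induction d λ s b → combine-induction d (cross′ s b)
  }
  where
  open FoolingSet fooling
  B : BinMat (n * d) (m * d)
  B = blockDiagonal A d
  hit′ : ∀ s b → T (B (blockwise d row (combine s b)) (blockwise d col (combine s b)))
  hit′ s b rewrite blockwise-combine d row s b | blockwise-combine d col s b
                 | blockDiagonal-diagonal A d (row s) (col s) b = hit s
  cross′ : ∀ s b s′ b′ → T (B (blockwise d row (combine s b)) (blockwise d col (combine s′ b′))) →
           T (B (blockwise d row (combine s′ b′)) (blockwise d col (combine s b))) →
           combine {r} s b ≡ combine s′ b′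
  cross′ s b s′ b′ h h′
    rewrite blockwise-combine d row s b | blockwise-combine d col s′ b′
          | blockwise-combine d row s′ b′ | blockwise-combine d col s b
    with refl ← blockDiagonal-sameBlock A d (row s) (col s′) h
    rewrite blockDiagonal-diagonal A d (row s) (col s′) b | blockDiagonal-diagonal A d (row s′) (col s) b
    = cong (λ s → combine s b) (cross s s′ h h′)

inBlock-injective : ∀ {m d} (b : Fin d) → Injective _≡_ _≡_ (λ (s : Fin m) → combine s b)
inBlock-injective b {s} {s′} = combine-injectiveˡ s b s′ b

blockDiagonal-independent : ∀ {n m r d} {A : BinMat n m} {f : Fin r → Fin m} →
                            LinIndep (columns A f) → LinIndep (columns (blockDiagonal A d) (blockwise d f))
blockDiagonal-independent {n} {m} {r} {d} {A} {f} independent c combination =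
  combine-induction d λ s b → independent (λ s → c (combine s b)) (blockCombination b) s
  where
  B : BinMat (n * d) (m * d)
  B = blockDiagonal A d
  blockCombination : ∀ b i → sumℚ (λ s → c (combine s b) *ℚ b2ℚ (A i (f s))) ≡ 0ℚ
  blockCombination b i = begin
    sumℚ (λ s → c (combine s b) *ℚ b2ℚ (A i (f s)))
      ≡⟨ sumℚ-cong (λ s → cong (λ x → c (combine s b) *ℚ b2ℚ x) (entry s)) ⟨
    sumℚ (λ (s : Fin r) → term (combine s b))
      ≡⟨ sumℚ-reindex (inBlock-injective b) term (combine-induction d outside) ⟨
    sumℚ term
      ≡⟨ combination (combine i b) ⟩
    0ℚ ∎
    where
    open ≡-Reasoning
    term : Fin (r * d) → ℚ
    term t = c t *ℚ b2ℚ (B (combine i b) (blockwise d f t))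
    entry : ∀ s → B (combine i b) (blockwise d f (combine s b)) ≡ A i (f s)
    entry s rewrite blockwise-combine d f s b = blockDiagonal-diagonal A d i (f s) b
    outside : ∀ s b′ → (∀ s′ → combine s′ b ≢ combine s b′) → term (combine s b′) ≡ 0ℚ
    outside s b′ unhit = begin
      c (combine s b′) *ℚ b2ℚ (B (combine i b) (blockwise d f (combine s b′)))
        ≡⟨ cong (λ x → c (combine s b′) *ℚ b2ℚ (B (combine i b) x)) (blockwise-combine d f s b′) ⟩
      c (combine s b′) *ℚ b2ℚ (B (combine i b) (combine (f s) b′))
        ≡⟨ cong (λ x → c (combine s b′) *ℚ b2ℚ x) (blockDiagonal-offDiagonal A d i (f s) b≢b′) ⟩
      c (combine s b′) *ℚ 0ℚ
        ≡⟨ *-zeroʳ (c (combine s b′)) ⟩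
      0ℚ ∎
      where
      b≢b′ : b ≢ b′
      b≢b′ refl = unhit s refl

blockDiagonal-columnDependency : ∀ {n m d} {A : BinMat n m} (a : Fin m → ℚ) →
  (∀ i → sumℚ (λ r → a r *ℚ b2ℚ (A i r)) ≡ 0ℚ) →
  ∀ b x → sumℚ (λ r → a r *ℚ b2ℚ (blockDiagonal A d x (combine r b))) ≡ 0ℚ
blockDiagonal-columnDependency {d = d} {A} a dependency b = combine-induction d blockRow
  where
  blockRow : ∀ i b′ →
             sumℚ (λ r → a r *ℚ b2ℚ (blockDiagonal A d (combine i b′) (combine r b))) ≡ 0ℚ
  blockRow i b′ with b′ ≟ b
  ... | yes refl =
    trans (sumℚ-cong (λ r → cong (λ x → a r *ℚ b2ℚ x) (blockDiagonal-diagonal A d i r b))) (dependency i)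
  ... | no b′≢b  =
    sumℚ-zero (λ r → trans (cong (λ x → a r *ℚ b2ℚ x) (blockDiagonal-offDiagonal A d i r b′≢b))
                           (*-zeroʳ (a r)))

remQuot-injective : ∀ {m} d → Injective _≡_ _≡_ (remQuot {m} d)
remQuot-injective {m} d = Injection.injective (↔⇒↣ (*↔× {m} {d}))

-- If every block misses a column, punching that column out of each block squeezes the
-- image of `g` into `Fin (k * d)`.
module _ {k d} (g : Fin (suc (k * d)) → Fin (suc k * d))
         (missing : Fin d → Fin (suc k)) (unhit : ∀ b t → g t ≢ combine (missing b) b) where

  private
    squeeze : (x : Fin (suc k) × Fin d) → missing (proj₂ x) ≢ proj₁ x → Fin (k * d)
    squeeze (r , b) r≢missing = combine (punchOut r≢missing) b

    squeeze-injective : ∀ x y p q → squeeze x p ≡ squeeze y q → x ≡ y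
    squeeze-injective (r , b) (r′ , b′) p q same
      with combine-injective (punchOut p) b (punchOut q) b′ same
    ... | punchOut≡ , refl = cong (_, b) (punchOut-injective p q punchOut≡)

    avoids : ∀ t → missing (proj₂ (remQuot {suc k} d (g t))) ≢ proj₁ (remQuot {suc k} d (g t))
    avoids t missing≡ = unhit _ t (begin
      g t                                          ≡⟨ combine-remQuot {suc k} d (g t) ⟨
      uncurry combine (remQuot {suc k} d (g t))    ≡⟨ cong (λ r → combine r _) missing≡ ⟨
      combine (missing _) _                        ∎)
      where open ≡-Reasoning

  collision-unless-fullBlock : ∃₂ λ i j → i ≢ j × g i ≡ g j
  collision-unless-fullBlock
    with pigeonhole (n<1+n (k * d)) (λ t → squeeze (remQuot {suc k} d (g t)) (avoids t))
  ... | i , j , i<j , same =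
    i , j , <⇒≢ i<j , remQuot-injective {suc k} d (squeeze-injective _ _ _ _ same)

fullBlock-or-collision : ∀ {k d} (g : Fin (suc (k * d)) → Fin (suc k * d)) →
                         (∃ λ b → ∀ r → ∃ λ t → g t ≡ combine r b) ⊎ (∃₂ λ i j → i ≢ j × g i ≡ g j)
fullBlock-or-collision {k} {d} g
  with any? (λ b → all? (λ (r : Fin (suc k)) → any? (λ t → g t ≟ combine r b)))
... | yes full = inj₁ full
... | no ¬full =
  inj₂ (collision-unless-fullBlock g (proj₁ ∘ gap) (λ b t eq → proj₂ (gap b) (t , eq)))
  where
  gap : ∀ b → ∃ λ (r : Fin (suc k)) → ¬ ∃ λ t → g t ≡ combine r b
  gap b = ¬∀⟶∃¬ (suc k) _ (λ r → any? (λ t → g t ≟ combine r b)) (λ covered → ¬full (b , covered))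

blockDiagonal-dependent : ∀ {n k d} {A : BinMat n (suc k)} (a : Fin (suc k) → ℚ) (p : Fin (suc k)) →
  a p ≢ 0ℚ → (∀ i → sumℚ (λ r → a r *ℚ b2ℚ (A i r)) ≡ 0ℚ) →
  (g : Fin (suc (k * d)) → Fin (suc k * d)) → ¬ LinIndep (columns (blockDiagonal A d) g)
blockDiagonal-dependent {k = k} {d} {A} a p ap≢0 dependency g independent
  with fullBlock-or-collision g
... | inj₂ (i , j , i≢j , gi≡gj) =
  i≢j (LinIndep-injective {v = columns (blockDiagonal A d) g} independent
         (λ x → cong (λ y → b2ℚ (blockDiagonal A d x y)) gi≡gj))
... | inj₁ (b , covered) =
  ap≢0 (LinIndep-∘ {v = columns (blockDiagonal A d) g} t-injective independent a blockCombination p)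
  where
  t : Fin (suc k) → Fin (suc (k * d))
  t r = proj₁ (covered r)
  g∘t : ∀ r → g (t r) ≡ combine r b
  g∘t r = proj₂ (covered r)
  t-injective : Injective _≡_ _≡_ t
  t-injective {r} {r′} tr≡tr′ =
    inBlock-injective b (trans (sym (g∘t r)) (trans (cong g tr≡tr′) (g∘t r′)))
  blockCombination : ∀ x → sumℚ (λ r → a r *ℚ b2ℚ (blockDiagonal A d x (g (t r)))) ≡ 0ℚ
  blockCombination x =
    trans (sumℚ-cong (λ r → cong (λ y → a r *ℚ b2ℚ (blockDiagonal A d x y)) (g∘t r)))
          (blockDiagonal-columnDependency {A = A} a dependency b x)

cycle : Fin 4 → Fin 4
cycle 0F = 1F
cycle 1F = 2F
cycle 2F = 3F
cycle 3F = 0F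

cycle²-fixpointFree : ∀ r → cycle (cycle r) ≢ r
cycle²-fixpointFree 0F ()
cycle²-fixpointFree 1F ()
cycle²-fixpointFree 2F ()
cycle²-fixpointFree 3F ()

C₄ : BinMat 4 4
C₄ i j = does (j ≟ i) ∨ does (j ≟ cycle i)

C₄-ones : ∀ {i j} → T (C₄ i j) → j ≡ i ⊎ j ≡ cycle i
C₄-ones {i} {j} entry with j ≟ i | j ≟ cycle i
... | yes j≡i | _        = inj₁ j≡i
... | no _    | yes j≡ci = inj₂ j≡ci

C₄-reflexive : ∀ r → T (C₄ r r)
C₄-reflexive r rewrite dec-true (r ≟ r) refl = tt

C₄-antisymmetric : ∀ r s → T (C₄ r s) → T (C₄ s r) → r ≡ s
C₄-antisymmetric r s rs sr with C₄-ones rs | C₄-ones sr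
... | inj₁ s≡r    | _           = sym s≡r
... | inj₂ _      | inj₁ r≡s    = r≡s
... | inj₂ s≡cr   | inj₂ r≡cs   =
  contradiction (trans (cong cycle (sym s≡cr)) (sym r≡cs)) (cycle²-fixpointFree r)

C₄-foolingSet : FoolingSet C₄ 4
C₄-foolingSet = record { row = id ; col = id ; hit = C₄-reflexive ; cross = C₄-antisymmetric }

alternating : Fin 4 → ℚ
alternating = 1ℚ ∷ - 1ℚ ∷ 1ℚ ∷ - 1ℚ ∷ []

C₄-alternating : ∀ i → sumℚ (λ r → alternating r *ℚ b2ℚ (C₄ i r)) ≡ 0ℚ
C₄-alternating 0F = refl
C₄-alternating 1F = refl
C₄-alternating 2F = refl
C₄-alternating 3F = refl

C₄-independent : LinIndep (columns C₄ inject₁)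
C₄-independent x combination = λ { 0F → x₀≡0 ; 1F → x₁≡0 ; 2F → x₂≡0 }
  where
  open +-*-Solver
  open ≡-Reasoning
  row : Fin 4 → ℚ
  row i = sumℚ (λ t → x t *ℚ b2ℚ (C₄ i (inject₁ t)))
  x₀≡0 : x 0F ≡ 0ℚ
  x₀≡0 = begin
    x 0F    ≡⟨ solve 3 (λ a b c → a := a :* con 1ℚ :+ (b :* con 0ℚ :+ (c :* con 0ℚ :+ con 0ℚ)))
                       refl (x 0F) (x 1F) (x 2F) ⟩
    row 3F  ≡⟨ combination 3F ⟩
    0ℚ      ∎
  x₂≡0 : x 2F ≡ 0ℚ
  x₂≡0 = begin
    x 2F    ≡⟨ solve 3 (λ a b c → c := a :* con 0ℚ :+ (b :* con 0ℚ :+ (c :* con 1ℚ :+ con 0ℚ)))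
                       refl (x 0F) (x 1F) (x 2F) ⟩
    row 2F  ≡⟨ combination 2F ⟩
    0ℚ      ∎
  x₁≡0 : x 1F ≡ 0ℚ
  x₁≡0 = begin
    x 1F             ≡⟨ solve 3 (λ a b c → b := (a :* con 1ℚ :+ (b :* con 1ℚ :+ (c :* con 0ℚ :+ con 0ℚ)))
                                                 :- (a :* con 1ℚ :+ (b :* con 0ℚ :+ (c :* con 0ℚ :+ con 0ℚ))))
                                refl (x 0F) (x 1F) (x 2F) ⟩
    row 0F - row 3F  ≡⟨ cong₂ _-_ (combination 0F) (combination 3F) ⟩
    0ℚ - 0ℚ          ≡⟨⟩
    0ℚ               ∎

theorem3 : ∀ (d : ℕ) → 1 ≤ d →
    Σ ℕ λ n → Σ ℕ λ m → Σ (BinMat n m) λ M →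
      BinaryRankAtLeast M (4 * d) × RankIs M (3 * d)
theorem3 d _ =
  4 * d , 4 * d , blockDiagonal C₄ d ,
  FoolingSet⇒BinaryRankAtLeast (blockDiagonal-foolingSet {d = d} C₄-foolingSet) ,
  (blockwise {3} d inject₁ , blockDiagonal-independent {d = d} {C₄} {inject₁} C₄-independent) ,
  blockDiagonal-dependent {d = d} {C₄} alternating 0F 1≢0 C₄-alternating
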